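{- Let $D,A$ be sets and $v:\mathbb{X}\to\mathsf{R}(D,A)$ a valuation. For every $T\subseteq D^A$ and every lattice term $s$, $[\![s]\!]_{v_T}\subseteq[\![s]\!]_v$ (componentwise inclusion), where $[\![s]\!]_{v_T}$ is computed in the lattice $\mathsf{R}(D,A)_T$ and $[\![s]\!]_v$ in $\mathsf{R}(D,A)$.
   Context: Lattice terms: $t::=x\mid\top\mid t\wedge t\mid\bot\mid t\vee t$, $x\in\mathbb{X}$. $D^A$ is the set of functions $A\to D$, $\delta(f,g)=\{a\in A\mid f(a)\neq g(a)\}$, $\overline{X}^{\alpha}=\{g\in D^A\mid\exists f\in X,\ \delta(f,g)\subseteq\alpha\}$, and $X$ is $\alpha$-closed if $X=\overline{X}^{\alpha}$. $\mathsf{R}(D,A)$ is the complete lattice of pairs $(\alpha,X)$, $\alpha\subseteq A$, $X\subseteq D^A$ $\alpha$-closed, ordered componentwise; meets are componentwise intersections and $\bigvee_i(\alpha_i,X_i)=(\bigcup\alpha_i,\overline{\bigcup X_i}^{\bigcup\alpha_i})$. For $T\subseteq D^A$ let $\mathrm{int}_T(\alpha,X)=(\alpha,\overline{X\cap T}^{\alpha})$; $\mathsf{R}(D,A)_T$ is the set of pairs $\mathrm{int}_T(\alpha,X)$, $\alpha\subseteq A$, $X\subseteq D^A$; it is a complete lattice with joins computed as in $\mathsf{R}(D,A)$ and meets $\bigwedge^T_i(\alpha_i,X_i)=\mathrm{int}_T(\bigcap_i\alpha_i,\bigcap_iX_i)$. The valuation $v_T:\mathbb{X}\to\mathsf{R}(D,A)_T$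 is $v_T(x)=\mathrm{int}_T(v(x))$. -}

module Defs where

open import Data.Product using (Σ; _×_; _,_; ∃)
open import Data.Sum using (_⊎_)
open import Data.Empty using (⊥)
open import Data.Unit using (⊤)
open import Relation.Nullary using (¬_)
open import Relation.Binary.PropositionalEquality using (_≡_; _≢_)

Subset : Set → Set₁
Subset S = S → Set

_⊆_ : {S : Set} → Subset S → Subset S → Set
P ⊆ Q = ∀ x → P x → Q x

data Term (𝕏 : Set) : Set where
  var  : 𝕏 → Term 𝕏
  top  : Term 𝕏
  _∧ₜ_ : Term 𝕏 → Term 𝕏 → Term 𝕏
  bot  : Term 𝕏
  _∨ₜ_ : Term 𝕏 → Term 𝕏 → Term 𝕏

module _ (D A : Set) where

  Fun : Set
  Fun = A → D

  δ : Fun → Fun → Subset A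
  δ f g a = f a ≢ g a

  closure : Subset A → Subset Fun → Subset Fun
  closure α X g = Σ Fun λ f → X f × (δ f g ⊆ α)

  IsClosed : Subset A → Subset Fun → Set
  IsClosed α X = (X ⊆ closure α X) × (closure α X ⊆ X)

  -- Pairs (α , X) with α ⊆ A, X ⊆ D^A (carriers of R(D,A) and R(D,A)_T)
  record Pair : Set₁ where
    constructor ⟨_,_⟩
    field
      att : Subset A
      rel : Subset Fun
  open Pair public

  record R : Set₁ where
    field
      pair   : Pair
      closed : IsClosed (att pair) (rel pair)
  open R public

  _≤P_ : Pair → Pair → Set
  p ≤P q = (att p ⊆ att q) × (rel p ⊆ rel q)

  _∩_ : {S : Set} → Subset S → Subset S → Subset S
  (P ∩ Q) x = P x × Q x

  _∪_ : {S : Set} → Subset S → Subset S → Subset S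
  (P ∪ Q) x = P x ⊎ Q x

  full : {S : Set} → Subset S
  full _ = ⊤

  empty : {S : Set} → Subset S
  empty _ = ⊥

  topR : Pair
  topR = ⟨ full , full ⟩

  botR : Pair
  botR = ⟨ empty , empty ⟩

  meetR : Pair → Pair → Pair
  meetR p q = ⟨ att p ∩ att q , rel p ∩ rel q ⟩

  joinR : Pair → Pair → Pair
  joinR p q = ⟨ att p ∪ att q , closure (att p ∪ att q) (rel p ∪ rel q) ⟩

  int : Subset Fun → Pair → Pair
  int T p = ⟨ att p , closure (att p) (rel p ∩ T) ⟩

  -- Lattice operations of R(D,A)_T
  -- top = empty meet = int_T(A, D^A); bottom = empty join = (∅, closure_∅ ∅)
  topT : Subset Fun → Pair
  topT T = int T ⟨ full , full ⟩

  botT : Subset Fun → Pair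
  botT T = ⟨ empty , closure empty empty ⟩

  meetT : Subset Fun → Pair → Pair → Pair
  meetT T p q = int T ⟨ att p ∩ att q , rel p ∩ rel q ⟩

  joinT : Subset Fun → Pair → Pair → Pair
  joinT T p q = joinR p q

  ⟦_⟧ : {𝕏 : Set} → Term 𝕏 → (𝕏 → R) → Pair
  ⟦ var x ⟧ v = pair (v x)
  ⟦ top ⟧ v = topR
  ⟦ s ∧ₜ t ⟧ v = meetR (⟦ s ⟧ v) (⟦ t ⟧ v)
  ⟦ bot ⟧ v = botR
  ⟦ s ∨ₜ t ⟧ v = joinR (⟦ s ⟧ v) (⟦ t ⟧ v)

  -- Interpretation of terms in R(D,A)_T under v_T(x) = int_T(v(x))
  ⟦_⟧T : {𝕏 : Set} → Term 𝕏 → Subset Fun → (𝕏 → R) → Pair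
  ⟦ var x ⟧T T v = int T (pair (v x))
  ⟦ top ⟧T T v = topT T
  ⟦ s ∧ₜ t ⟧T T v = meetT T (⟦ s ⟧T T v) (⟦ t ⟧T T v)
  ⟦ bot ⟧T T v = botT T
  ⟦ s ∨ₜ t ⟧T T v = joinT T (⟦ s ⟧T T v) (⟦ t ⟧T T v)

-- Every plain value ⟦s⟧ v is closed: a meet of closed sets is closed under the
-- smaller attribute set, and a join is a closure, which is idempotent because
-- δ satisfies the triangle inequality δ(f,h) ⊆ δ(f,g) ∪ δ(g,h) (this is where
-- excluded middle enters). The T-operations only shrink relations (restricting
-- to T before closing) and close under attribute sets that are already
-- smaller, so closedness of the plain value absorbs their closures.
module Submission where

open import Defs
open import Axiom.ExcludedMiddle using (ExcludedMiddle)
open import Level using (0ℓ)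
open import Function using (_∘_)
open import Data.Product using (_,_; proj₁; proj₂)
open import Data.Sum using (inj₁; inj₂; [_,_])
open import Data.Unit using (tt)
open import Relation.Nullary using (yes; no)
open import Relation.Binary.PropositionalEquality using (_≡_; trans)

module _ (D A : Set) where

  ∩-mono : {S : Set} {P P′ Q Q′ : Subset S} →
    P ⊆ P′ → Q ⊆ Q′ → _∩_ D A P Q ⊆ _∩_ D A P′ Q′
  ∩-mono p q x (px , qx) = p x px , q x qx

  ∪-mono : {S : Set} {P P′ Q Q′ : Subset S} →
    P ⊆ P′ → Q ⊆ Q′ → _∪_ D A P Q ⊆ _∪_ D A P′ Q′
  ∪-mono p q x = [ (λ px → inj₁ (p x px)) , (λ qx → inj₂ (q x qx)) ]

  closure-mono : {α β : Subset A} {X Y : Subset (Fun D A)} →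
    α ⊆ β → X ⊆ Y → closure D A α X ⊆ closure D A β Y
  closure-mono α⊆β X⊆Y g (f , Xf , δ⊆α) = f , X⊆Y f Xf , λ a d → α⊆β a (δ⊆α a d)

  δ-triangle : ExcludedMiddle 0ℓ → (f g h : Fun D A) →
    δ D A f h ⊆ _∪_ D A (δ D A f g) (δ D A g h)
  δ-triangle em f g h a f≢h with em {f a ≡ g a}
  ... | yes f≡g = inj₂ (λ g≡h → f≢h (trans f≡g g≡h))
  ... | no f≢g  = inj₁ f≢g

  closure-idem : ExcludedMiddle 0ℓ → {α : Subset A} {X : Subset (Fun D A)} →
    closure D A α (closure D A α X) ⊆ closure D A α X
  closure-idem em h (g , (f , Xf , δfg⊆α) , δgh⊆α) =
    f , Xf , λ a d → [ δfg⊆α a , δgh⊆α a ] (δ-triangle em f g h a d)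

  ⟦⟧-closed : ExcludedMiddle 0ℓ → {𝕏 : Set} (v : 𝕏 → R D A) (s : Term 𝕏) →
    let p = ⟦_⟧ D A s v in closure D A (att p) (rel p) ⊆ rel p
  ⟦⟧-closed em v (var x) = proj₂ (closed (v x))
  ⟦⟧-closed em v top g _ = tt
  ⟦⟧-closed em v (s ∧ₜ t) g cl =
    ⟦⟧-closed em v s g (closure-mono (λ _ → proj₁) (λ _ → proj₁) g cl) ,
    ⟦⟧-closed em v t g (closure-mono (λ _ → proj₂) (λ _ → proj₂) g cl)
  ⟦⟧-closed em v bot g (f , () , _)
  ⟦⟧-closed em v (s ∨ₜ t) = closure-idem em

  int-≤P : (T : Subset (Fun D A)) {p q : Pair D A} → _≤P_ D A p q →
    closure D A (att q) (rel q) ⊆ rel q → _≤P_ D A (int D A T p) q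
  int-≤P T (α⊆β , X⊆Y) q-closed =
    α⊆β , λ g cl → q-closed g (closure-mono α⊆β (λ f → X⊆Y f ∘ proj₁) g cl)

  meetR-mono : {p p′ q q′ : Pair D A} → _≤P_ D A p p′ → _≤P_ D A q q′ →
    _≤P_ D A (meetR D A p q) (meetR D A p′ q′)
  meetR-mono (αp , Xp) (αq , Xq) = ∩-mono αp αq , ∩-mono Xp Xq

  joinR-mono : {p p′ q q′ : Pair D A} → _≤P_ D A p p′ → _≤P_ D A q q′ →
    _≤P_ D A (joinR D A p q) (joinR D A p′ q′)
  joinR-mono (αp , Xp) (αq , Xq) =
    ∪-mono αp αq , closure-mono (∪-mono αp αq) (∪-mono Xp Xq)

  ⟦⟧T≤P⟦⟧ : ExcludedMiddle 0ℓ → {𝕏 : Set} (v : 𝕏 → R D A)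
    (T : Subset (Fun D A)) (s : Term 𝕏) →
    _≤P_ D A (⟦_⟧T D A s T v) (⟦_⟧ D A s v)
  ⟦⟧T≤P⟦⟧ em v T (var x) =
    int-≤P T ((λ _ a → a) , (λ _ f → f)) (⟦⟧-closed em v (var x))
  ⟦⟧T≤P⟦⟧ em v T top = (λ _ a → a) , λ _ _ → tt
  ⟦⟧T≤P⟦⟧ em v T (s ∧ₜ t) =
    int-≤P T (meetR-mono (⟦⟧T≤P⟦⟧ em v T s) (⟦⟧T≤P⟦⟧ em v T t))
      (⟦⟧-closed em v (s ∧ₜ t))
  ⟦⟧T≤P⟦⟧ em v T bot = (λ _ ()) , λ { _ (_ , () , _) }
  ⟦⟧T≤P⟦⟧ em v T (s ∨ₜ t) =
    joinR-mono (⟦⟧T≤P⟦⟧ em v T s) (⟦⟧T≤P⟦⟧ em v T t)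

mainTheorem4 : ExcludedMiddle 0ℓ →
    (D A 𝕏 : Set) (v : 𝕏 → R D A) (T : Subset (Fun D A)) (s : Term 𝕏) →
    _≤P_ D A (⟦_⟧T D A s T v) (⟦_⟧ D A s v)
mainTheorem4 em D A 𝕏 v T s = ⟦⟧T≤P⟦⟧ D A em v T s
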